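{- For every $N\in\mathbb N^*$, $\mathfrak m_1(N)=1$ and \begin{equation} \mathfrak m_2(N) =N\,. \end{equation}
   Context: For $N\in\mathbb N^*=\mathbb N\setminus\{0\}$, let $\mathfrak M(N)$ be the family of arrays $\mathfrak A=(a^n_i)$ with $N$ rows, each row an infinite strictly increasing sequence of reals. The spectrum of $\mathfrak A$ is the set of all sums $\lambda=\sum_{n=1}^N a^n_{j_n}$ with $(j_1,\dots,j_N)\in(\mathbb N^*)^N$, and the multiplicity of $\lambda$ is the number of such $N$-tuples representing it. Ordering the spectrum as a non-decreasing sequence $\lambda_1(\mathfrak A)\le\lambda_2(\mathfrak A)\le\dots$ counted with multiplicity, set $m(k,\mathfrak A)$ = multiplicity of $\lambda_k(\mathfrak A)$ and $\mathfrak m_k(N)=\sup_{\mathfrak A\in\mathfrak M(N)} m(k,\mathfrak A)$. -}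

module Defs where

open import Data.Nat as ℕ using (ℕ; zero; suc)
open import Data.Fin using (Fin)
open import Data.Vec using (Vec; lookup)
open import Data.List using (List; length)
open import Data.List.Membership.Propositional using (_∈_)
open import Data.List.Relation.Unary.All using (All)
open import Data.List.Relation.Unary.Unique.Propositional using (Unique)
open import Data.Product using (Σ; _×_; _,_)
open import Data.Sum using (_⊎_)
open import Relation.Binary.PropositionalEquality using (_≡_)
open import Relation.Binary.Definitions using (Trichotomous)
open import Relation.Nullary using (¬_)
open import Function.Bundles using (_⇔_)
open import Algebra.Structures using (IsCommutativeRing)

-- The real numbers, given axiomatically as a Dedekind-complete ordered
-- field (the stdlib has no reals).  The theorem is stated for an
-- arbitrary model of these axioms, i.e. for ℝ.

record RealField : Set₁ where
  infixl 6 _+_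
  infixl 7 _*_
  infix  4 _<_ _≤_
  field
    Carrier : Set
    _+_ _*_ : Carrier → Carrier → Carrier
    -_      : Carrier → Carrier
    0ℝ 1ℝ   : Carrier
    _<_     : Carrier → Carrier → Set
    isCommutativeRing : IsCommutativeRing _≡_ _+_ _*_ -_ 0ℝ 1ℝ
    0≢1     : ¬ (0ℝ ≡ 1ℝ)
    inverse : ∀ x → ¬ (x ≡ 0ℝ) → Σ Carrier (λ y → x * y ≡ 1ℝ)
    <-trans : ∀ {x y z} → x < y → y < z → x < z
    <-tri   : Trichotomous _≡_ _<_
    +-mono-< : ∀ {x y} z → x < y → x + z < y + z
    *-pos   : ∀ {x y} → 0ℝ < x → 0ℝ < y → 0ℝ < x * y

  _≤_ : Carrier → Carrier → Set
  x ≤ y = x < y ⊎ x ≡ y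

  field
    complete : (P : Carrier → Set) → Σ Carrier P →
               Σ Carrier (λ b → ∀ x → P x → x ≤ b) →
               Σ Carrier (λ s → (∀ x → P x → x ≤ s) ×
                                (∀ b → (∀ x → P x → x ≤ b) → s ≤ b))

module Spectrum (R : RealField) where
  open RealField R

  -- An array with N rows; row n is the sequence i ↦ a n i, where index
  -- i : ℕ stands for the (i+1)-th entry (0-based indexing of ℕ*).
  Array : ℕ → Set
  Array N = Fin N → ℕ → Carrier

  InM : (N : ℕ) → Array N → Set
  InM N a = ∀ n i → a n i < a n (suc i)

  Tuple : ℕ → Set
  Tuple N = Vec ℕ N

  sumFin : (N : ℕ) → (Fin N → Carrier) → Carrier
  sumFin zero    f = 0ℝ
  sumFin (suc N) f = f Fin.zero + sumFin N (λ n → f (Fin.suc n))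

  tsum : {N : ℕ} → Array N → Tuple N → Carrier
  tsum {N} a t = sumFin N (λ n → a n (lookup t n))

  Multiplicity : {N : ℕ} → Array N → Carrier → ℕ → Set
  Multiplicity {N} a λ' m =
    Σ (List (Tuple N)) (λ l → Unique l × length l ≡ m ×
       (∀ t → (t ∈ l) ⇔ (tsum a t ≡ λ')))

  -- λ = λ_k(𝔄) in the non-decreasing enumeration counted with
  -- multiplicity: fewer than k tuples have sum < λ, and at least k
  -- tuples have sum ≤ λ.
  IsKth : {N : ℕ} → Array N → ℕ → Carrier → Set
  IsKth {N} a k λ' =
    (∀ (l : List (Tuple N)) → Unique l → All (λ t → tsum a t < λ') l →
       length l ℕ.< k)
    × Σ (List (Tuple N)) (λ l → Unique l × All (λ t → tsum a t ≤ λ') l ×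
         length l ≡ k)

  MultAt : {N : ℕ} → Array N → ℕ → ℕ → Set
  MultAt a k m = Σ Carrier (λ λ' → IsKth a k λ' × Multiplicity a λ' m)

  -- 𝔪_k(N) = m  (supremum over 𝔐(N), with value m ∈ ℕ: an upper bound
  -- that is attained).
  SupMult : ℕ → ℕ → ℕ → Set
  SupMult N k m =
    (∀ (a : Array N) → InM N a → ∀ m' → MultAt a k m' → m' ℕ.≤ m)
    × Σ (Array N) (λ a → InM N a × MultAt a k m)

-- Every index tuple dominates the zero tuple componentwise, and strictly
-- unless it is the zero tuple itself; since rows increase strictly, the sum
-- of the zero tuple is the unique smallest point of the spectrum, so
-- 𝔪₁ = 1. A tuple other than zero and the unit tuples e_k strictly
-- dominates some e_k, which in turn strictly dominates zero; so its sum has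
-- two tuples strictly below it and cannot be λ₂. Hence λ₂ is represented
-- either by the zero tuple alone or by unit tuples only, and 𝔪₂ ≤ N. Any
-- array with equal rows ties all unit tuples at λ₂, giving 𝔪₂ = N.
module Submission where

open import Defs
open import Data.Nat using (ℕ; _≤_)
open import Data.Product using (_×_)

open import Data.Nat as ℕ using (zero; suc; z≤n; s≤s)
import Data.Nat.Properties as ℕₚ
open import Data.Fin using (Fin) renaming (zero to fz; suc to fs)
open import Data.Vec using (Vec; []; _∷_; replicate)
import Data.Vec.Properties as Vecₚ
open import Data.Vec.Relation.Binary.Pointwise.Inductive using (Pointwise; []; _∷_)
open import Data.List using (List; []; _∷_; length; tabulate; filter)
open import Data.List.Properties using (filter-notAll; length-tabulate)
open import Data.List.Membership.Propositional using (_∈_)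
open import Data.List.Membership.Propositional.Properties using (∈-filter⁺; ∈-tabulate⁺; ∈-tabulate⁻)
open import Data.List.Relation.Binary.Subset.Propositional using (_⊆_)
open import Data.List.Relation.Unary.Any using (here; there)
import Data.List.Relation.Unary.Any as Any
open import Data.List.Relation.Unary.All using ([]; _∷_)
import Data.List.Relation.Unary.All as All
open import Data.List.Relation.Unary.Unique.Propositional using (Unique)
open import Data.List.Relation.Unary.Unique.Propositional.Properties using (tabulate⁺)
open import Data.List.Relation.Unary.AllPairs using ([]; _∷_)
open import Data.Product using (∃; _,_; proj₁; proj₂)
open import Data.Sum using (_⊎_; inj₁; inj₂)
open import Data.Empty using (⊥-elim)
open import Function using (_∘_)
open import Function.Bundles using (mk⇔; Equivalence)
open import Relation.Nullary using (¬_; yes; no; ¬?; contradiction)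
open import Relation.Binary.PropositionalEquality
open import Relation.Binary.Definitions using (tri<; tri≈; tri>; DecidableEquality)
open import Algebra.Structures using (IsCommutativeRing)

module _ {A : Set} (_≟_ : DecidableEquality A) where

  unique-⊆⇒length-≤ : {xs ys : List A} → Unique xs → xs ⊆ ys → length xs ≤ length ys
  unique-⊆⇒length-≤ {[]}     _               _     = z≤n
  unique-⊆⇒length-≤ {x ∷ xs} {ys} (x∉xs ∷ uniq) xs⊆ys =
    ℕₚ.≤-trans (s≤s (unique-⊆⇒length-≤ uniq xs⊆ys∖x))
               (filter-notAll (¬? ∘ (x ≟_)) ys (Any.map (λ x≡y x≢y → x≢y x≡y) (xs⊆ys (here refl))))
    where
    xs⊆ys∖x : xs ⊆ filter (¬? ∘ (x ≟_)) ys
    xs⊆ys∖x z∈xs = ∈-filter⁺ (¬? ∘ (x ≟_)) (xs⊆ys (there z∈xs)) (All.lookup x∉xs z∈xs)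

zeros : ∀ N → Vec ℕ N
zeros N = replicate N 0

unit : ∀ {N} → Fin N → Vec ℕ N
unit fz     = 1 ∷ zeros _
unit (fs k) = 0 ∷ unit k

units : ∀ N → List (Vec ℕ N)
units N = tabulate unit

_≤*_ : ∀ {N} → Vec ℕ N → Vec ℕ N → Set
_≤*_ = Pointwise _≤_

_≟ᵥ_ : ∀ {N} → DecidableEquality (Vec ℕ N)
_≟ᵥ_ = Vecₚ.≡-dec ℕₚ._≟_

unit-injective : ∀ {N} {i j : Fin N} → unit i ≡ unit j → i ≡ j
unit-injective {i = fz}   {fz}   _  = refl
unit-injective {i = fs i} {fs j} eq = cong fs (unit-injective (Vecₚ.∷-injectiveʳ eq))

zeros≢unit : ∀ {N} (k : Fin N) → zeros N ≢ unit k
zeros≢unit fz     ()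
zeros≢unit (fs k) eq = zeros≢unit k (Vecₚ.∷-injectiveʳ eq)

zeros-≤* : ∀ {N} (t : Vec ℕ N) → zeros N ≤* t
zeros-≤* []      = []
zeros-≤* (_ ∷ t) = z≤n ∷ zeros-≤* t

zeros⊎above-unit : ∀ {N} (t : Vec ℕ N) → t ≡ zeros N ⊎ ∃ λ k → unit k ≤* t
zeros⊎above-unit []          = inj₁ refl
zeros⊎above-unit (suc _ ∷ t) = inj₂ (fz , s≤s z≤n ∷ zeros-≤* t)
zeros⊎above-unit (zero ∷ t) with zeros⊎above-unit t
... | inj₁ refl         = inj₁ refl
... | inj₂ (k , k≤*t)   = inj₂ (fs k , z≤n ∷ k≤*t)

zeros⊎unit⊎strictly-above-unit : ∀ {N} (t : Vec ℕ N) →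
  t ≡ zeros N ⊎ (∃ λ k → t ≡ unit k) ⊎ (∃ λ k → unit k ≤* t × unit k ≢ t)
zeros⊎unit⊎strictly-above-unit t with zeros⊎above-unit t
... | inj₁ t≡0 = inj₁ t≡0
... | inj₂ (k , k≤*t) with unit k ≟ᵥ t
...   | yes k≡t = inj₂ (inj₁ (k , sym k≡t))
...   | no  k≢t = inj₂ (inj₂ (k , k≤*t , k≢t))

module SpectrumProperties (R : RealField) where
  open RealField R renaming (_≤_ to _≤ᴿ_)
  open IsCommutativeRing isCommutativeRing using (+-comm; +-identityˡ; +-identityʳ; -‿inverseʳ)
  open Spectrum R

  <-irrefl : ∀ {x} → ¬ x < x
  <-irrefl {x} with <-tri x x
  ... | tri< _ _ x≮x = x≮x
  ... | tri≈ x≮x _ _ = x≮x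
  ... | tri> x≮x _ _ = x≮x

  <-≤-trans : ∀ {x y z} → x < y → y ≤ᴿ z → x < z
  <-≤-trans x<y (inj₁ y<z)  = <-trans x<y y<z
  <-≤-trans x<y (inj₂ refl) = x<y

  <⇒≱ : ∀ {x y} → x < y → ¬ y ≤ᴿ x
  <⇒≱ x<y y≤x = <-irrefl (<-≤-trans x<y y≤x)

  +-monoʳ-< : ∀ {x y} z → x < y → z + x < z + y
  +-monoʳ-< {x} {y} z x<y = subst₂ _<_ (+-comm x z) (+-comm y z) (+-mono-< z x<y)

  +-mono-<-≤ : ∀ {x y u v} → x < y → u ≤ᴿ v → x + u < y + v
  +-mono-<-≤ {y = y} x<y (inj₁ u<v) = <-trans (+-mono-< _ x<y) (+-monoʳ-< y u<v)
  +-mono-<-≤ x<y (inj₂ refl)         = +-mono-< _ x<y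

  +-mono-≤-< : ∀ {x y u v} → x ≤ᴿ y → u < v → x + u < y + v
  +-mono-≤-< (inj₁ x<y)  u<v = +-mono-<-≤ x<y (inj₁ u<v)
  +-mono-≤-< (inj₂ refl) u<v = +-monoʳ-< _ u<v

  +-mono-≤ : ∀ {x y u v} → x ≤ᴿ y → u ≤ᴿ v → x + u ≤ᴿ y + v
  +-mono-≤ x≤y         (inj₁ u<v)  = inj₁ (+-mono-≤-< x≤y u<v)
  +-mono-≤ (inj₁ x<y)  (inj₂ refl) = inj₁ (+-mono-< _ x<y)
  +-mono-≤ (inj₂ refl) (inj₂ refl) = inj₂ refl

  positive : ∃ (0ℝ <_)
  positive with <-tri 0ℝ 1ℝ
  ... | tri< 0<1 _ _ = 1ℝ , 0<1
  ... | tri≈ _ 0≡1 _ = ⊥-elim (0≢1 0≡1)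
  ... | tri> _ _ 1<0 = - 1ℝ , subst₂ _<_ (-‿inverseʳ 1ℝ) (+-identityˡ (- 1ℝ)) (+-mono-< (- 1ℝ) 1<0)

  module _ {f : ℕ → Carrier} (f-inc : ∀ i → f i < f (suc i)) where

    increasing⇒strictMono : ∀ {i} j → i ℕ.< j → f i < f j
    increasing⇒strictMono (suc j) (s≤s i≤j) with ℕₚ.m≤n⇒m<n∨m≡n i≤j
    ... | inj₁ i<j  = <-trans (increasing⇒strictMono j i<j) (f-inc j)
    ... | inj₂ refl = f-inc j

    increasing⇒mono : ∀ {i j} → i ≤ j → f i ≤ᴿ f j
    increasing⇒mono {j = j} i≤j with ℕₚ.m≤n⇒m<n∨m≡n i≤j
    ... | inj₁ i<j  = inj₁ (increasing⇒strictMono j i<j)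
    ... | inj₂ refl = inj₂ refl

  tsum-mono : ∀ {N} {a : Array N} → InM N a → {s t : Tuple N} → s ≤* t → tsum a s ≤ᴿ tsum a t
  tsum-mono inM []            = inj₂ refl
  tsum-mono inM (x≤y ∷ s≤*t) = +-mono-≤ (increasing⇒mono (inM fz) x≤y) (tsum-mono (inM ∘ fs) s≤*t)

  tsum-strictMono : ∀ {N} {a : Array N} → InM N a → {s t : Tuple N} → s ≤* t → s ≢ t →
                    tsum a s < tsum a t
  tsum-strictMono inM [] []≢[] = contradiction refl []≢[]
  tsum-strictMono inM (_∷_ {y = y} x≤y s≤*t) s≢t with ℕₚ.m≤n⇒m<n∨m≡n x≤y
  ... | inj₁ x<y  = +-mono-<-≤ (increasing⇒strictMono (inM fz) y x<y) (tsum-mono (inM ∘ fs) s≤*t)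
  ... | inj₂ refl = +-mono-≤-< (inj₂ refl) (tsum-strictMono (inM ∘ fs) s≤*t (s≢t ∘ cong (y ∷_)))

  module _ {N : ℕ} {a : Array N} (inM : InM N a) where

    zeros-minimum : ∀ {t} → t ≢ zeros N → tsum a (zeros N) < tsum a t
    zeros-minimum {t} t≢0 = tsum-strictMono inM (zeros-≤* t) (t≢0 ∘ sym)

    zeros-<-unit : ∀ k → tsum a (zeros N) < tsum a (unit k)
    zeros-<-unit k = zeros-minimum (zeros≢unit k ∘ sym)

    representatives-≤ : ∀ {λ' m} (S : List (Tuple N)) → Multiplicity a λ' m →
                        (∀ {t} → tsum a t ≡ λ' → t ∈ S) → m ≤ length S
    representatives-≤ S (l , uniq , refl , l⇔λ') reps⊆S =
      unique-⊆⇒length-≤ _≟ᵥ_ uniq (reps⊆S ∘ Equivalence.to (l⇔λ' _))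

    only-zeros-represents : ∀ {λ' t} → ¬ tsum a (zeros N) < λ' → tsum a t ≡ λ' → t ∈ zeros N ∷ []
    only-zeros-represents {t = t} 0≮λ' t≡λ' with t ≟ᵥ zeros N
    ... | yes t≡0 = here t≡0
    ... | no  t≢0 = contradiction (subst (_ <_) t≡λ' (zeros-minimum t≢0)) 0≮λ'

    only-units-represent-second : ∀ {λ' t} → IsKth a 2 λ' → tsum a (zeros N) < λ' →
                                  tsum a t ≡ λ' → t ∈ units N
    only-units-represent-second {t = t} (fewer-below , _) 0<λ' refl
      with zeros⊎unit⊎strictly-above-unit t
    ... | inj₁ refl                  = contradiction 0<λ' <-irrefl
    ... | inj₂ (inj₁ (k , refl))     = ∈-tabulate⁺ k
    ... | inj₂ (inj₂ (k , k≤*t , k≢t)) =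
      contradiction (fewer-below (zeros N ∷ unit k ∷ [])
                                 ((zeros≢unit k ∷ []) ∷ [] ∷ [])
                                 (<-trans (zeros-<-unit k) k<t ∷ k<t ∷ []))
                    (ℕₚ.<-irrefl refl)
      where
      k<t : tsum a (unit k) < tsum a t
      k<t = tsum-strictMono inM k≤*t k≢t

    zeros-not-below⇒multiplicity≤1 : ∀ {λ' m} → ¬ tsum a (zeros N) < λ' → Multiplicity a λ' m → m ≤ 1
    zeros-not-below⇒multiplicity≤1 0≮λ' mult =
      representatives-≤ (zeros N ∷ []) mult (only-zeros-represents 0≮λ')

    multAt-first≤1 : ∀ {m} → MultAt a 1 m → m ≤ 1
    multAt-first≤1 (λ' , (fewer-below , _) , mult) = zeros-not-below⇒multiplicity≤1 0≮λ' mult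
      where
      0≮λ' : ¬ tsum a (zeros N) < λ'
      0≮λ' 0<λ' = ℕₚ.<-irrefl refl (fewer-below (zeros N ∷ []) ([] ∷ []) (0<λ' ∷ []))

    multAt-first≡1 : MultAt a 1 1
    multAt-first≡1 =
      tsum a (zeros N) ,
      ((λ { [] _ _ → s≤s z≤n
          ; (t ∷ _) _ (t<0 ∷ _) → contradiction (tsum-mono inM (zeros-≤* t)) (<⇒≱ t<0) }) ,
       (zeros N ∷ [] , [] ∷ [] , inj₂ refl ∷ [] , refl)) ,
      (zeros N ∷ [] , [] ∷ [] , refl ,
       λ t → mk⇔ (λ { (here refl) → refl }) (only-zeros-represents <-irrefl))

    multAt-second≤N : 1 ≤ N → ∀ {m} → MultAt a 2 m → m ≤ N
    multAt-second≤N 1≤N (λ' , kth , mult) with <-tri (tsum a (zeros N)) λ'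
    ... | tri< 0<λ' _ _ = subst (_ ≤_) (length-tabulate unit)
                            (representatives-≤ (units N) mult (only-units-represent-second kth 0<λ'))
    ... | tri≈ 0≮λ' _ _ = ℕₚ.≤-trans (zeros-not-below⇒multiplicity≤1 0≮λ' mult) 1≤N
    ... | tri> 0≮λ' _ _ = ℕₚ.≤-trans (zeros-not-below⇒multiplicity≤1 0≮λ' mult) 1≤N

    tied-units⇒multAt-second : ∀ {σ} → (∀ k → tsum a (unit k) ≡ σ) → Fin N → MultAt a 2 N
    tied-units⇒multAt-second {σ} tied k₀ =
      σ ,
      ((λ l uniq l<σ → s≤s (unique-⊆⇒length-≤ _≟ᵥ_ uniq (below-σ ∘ All.lookup l<σ))) ,
       (zeros N ∷ unit k₀ ∷ [] , (zeros≢unit k₀ ∷ []) ∷ [] ∷ [] , inj₁ 0<σ ∷ inj₂ (tied k₀) ∷ [] , refl)) ,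
      (units N , tabulate⁺ unit-injective , length-tabulate unit ,
       λ t → mk⇔ (λ t∈units → let k , t≡k = ∈-tabulate⁻ t∈units in trans (cong (tsum a) t≡k) (tied k))
                 at-σ)
      where
      0<σ : tsum a (zeros N) < σ
      0<σ = subst (_ <_) (tied k₀) (zeros-<-unit k₀)

      σ-<-above-unit : ∀ {k t} → unit k ≤* t → unit k ≢ t → σ < tsum a t
      σ-<-above-unit {k} k≤*t k≢t = subst (_< _) (tied k) (tsum-strictMono inM k≤*t k≢t)

      below-σ : ∀ {t} → tsum a t < σ → t ∈ zeros N ∷ []
      below-σ {t} t<σ with zeros⊎unit⊎strictly-above-unit t
      ... | inj₁ t≡0                   = here t≡0
      ... | inj₂ (inj₁ (k , refl))     = contradiction (subst (_< σ) (tied k) t<σ) <-irrefl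
      ... | inj₂ (inj₂ (k , k≤*t , k≢t)) = contradiction (<-trans (σ-<-above-unit k≤*t k≢t) t<σ) <-irrefl

      at-σ : ∀ {t} → tsum a t ≡ σ → t ∈ units N
      at-σ {t} refl with zeros⊎unit⊎strictly-above-unit t
      ... | inj₁ refl                  = contradiction 0<σ <-irrefl
      ... | inj₂ (inj₁ (k , refl))     = ∈-tabulate⁺ k
      ... | inj₂ (inj₂ (k , k≤*t , k≢t)) = contradiction (σ-<-above-unit k≤*t k≢t) <-irrefl

  equalRows : ∀ {N} → (ℕ → Carrier) → Array N
  equalRows f _ = f

  module _ {f : ℕ → Carrier} (f0≡0 : f 0 ≡ 0ℝ) where

    tsum-equalRows-zeros : ∀ {N} → tsum (equalRows {N} f) (zeros N) ≡ 0ℝ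
    tsum-equalRows-zeros {zero}  = refl
    tsum-equalRows-zeros {suc N} = begin
      f 0 + tsum (equalRows f) (zeros N) ≡⟨ cong₂ _+_ f0≡0 (tsum-equalRows-zeros {N}) ⟩
      0ℝ + 0ℝ                            ≡⟨ +-identityˡ 0ℝ ⟩
      0ℝ                                 ∎
      where open ≡-Reasoning

    tsum-equalRows-unit : ∀ {N} (k : Fin N) → tsum (equalRows {N} f) (unit k) ≡ f 1
    tsum-equalRows-unit {suc N} fz = trans (cong (f 1 +_) (tsum-equalRows-zeros {N})) (+-identityʳ (f 1))
    tsum-equalRows-unit (fs k)     = trans (cong₂ _+_ f0≡0 (tsum-equalRows-unit k)) (+-identityˡ (f 1))

  ladder : ℕ → Carrier
  ladder zero    = 0ℝ
  ladder (suc i) = ladder i + proj₁ positive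

  ladder-increasing : ∀ i → ladder i < ladder (suc i)
  ladder-increasing i = subst (_< ladder (suc i)) (+-identityʳ (ladder i)) (+-monoʳ-< (ladder i) (proj₂ positive))

mainTheorem7 : (R : RealField) → (N : ℕ) → 1 ≤ N →
               Spectrum.SupMult R N 1 1 × Spectrum.SupMult R N 2 N
mainTheorem7 R (suc N) 1≤N =
  ((λ _ inM _ → multAt-first≤1 inM) , equalRows ladder , ladderRows , multAt-first≡1 ladderRows) ,
  ((λ _ inM _ → multAt-second≤N inM 1≤N) , equalRows ladder , ladderRows ,
   tied-units⇒multAt-second ladderRows (tsum-equalRows-unit {ladder} refl) fz)
  where
  open SpectrumProperties R
  open Spectrum R using (InM)

  ladderRows : InM (suc N) (equalRows ladder)
  ladderRows _ = ladder-increasing
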